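{- Let $\alpha=(a_1,\dots,a_n)\in\mathrm{UPF}_n$, and let $\pi_1|\pi_2|\cdots|\pi_m$ be its block structure. Then: (1) the number of rearrangements $\sigma$ of $\alpha$ such that $\sigma$ is again a unit interval parking function is $\binom{n}{|\pi_1|,\dots,|\pi_m|}$; (2) a rearrangement $\sigma$ of $\alpha$ lies in $\mathrm{UPF}_n$ if and only if, for each $j\in[m]$, the entries of $\sigma$ whose values belong to the block $\pi_j$ appear in $\sigma$ in the same relative order as in $\pi_j$ (i.e. in weakly increasing order).
   Context: Let $[n]=\{1,\dots,n\}$. A tuple $\alpha\in[n]^n$ is a parking function if for each $i\in[n]$ at least $i$ entries are at most $i$. Unit interval parking: $n$ cars enter in order $1,\dots,n$ a one-way street with spots $1,\dots,n$; with preference list $\alpha=(a_1,\dots,a_n)$, car $i$ parks in spot $a_i$ if free, otherwise in spot $a_i+1$ if it exists and is free, otherwise it fails. $\alpha$ is a unit interval parking function if all cars park; $\mathrm{UPF}_n$ denotes the set of these (they are parking functions). Block structure: for a parking function $\alpha$, let $\alpha^\uparrow=(a'_1,\dots,a'_n)$ be its weakly increasing rearrangement; cut $\alpha^\uparrow$ into consecutive segments $\pi_1|\pi_2|\cdots|\pi_m$ where a new segment begins at (and includes) each position $i$ with $a'_i=i$. Each $\pi_j$ is a block, $|\pi_j|$ its length. A rearrangement of $\alpha$ is any tuple obtained by permuting its entries. -}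

module Defs where

open import Data.Nat using (ℕ; zero; suc; _≤_; _≤?_; _≟_)
open import Data.Nat.Properties using (≤-decTotalOrder)
open import Data.Nat.Combinatorics using (_C_)
open import Data.Nat using (_+_; _*_)
open import Data.List using (List; []; _∷_; length; map)
open import Data.Nat.ListAction using (sum)
open import Data.List.Membership.DecPropositional _≟_ using (_∈?_)
open import Data.List.Relation.Unary.All using (All)
open import Data.Maybe using (Maybe; just; nothing; Is-just)
open import Data.Product using (_×_; _,_; proj₁; proj₂)
open import Relation.Nullary using (yes; no)
open import Relation.Binary.PropositionalEquality using (_≡_)
import Data.List.Sort.InsertionSort.Base as S

sortℕ : List ℕ → List ℕ
sortℕ = S.sort ≤-decTotalOrder

-- Unit interval parking of the preference list (cars in order) on spots 1..n,
-- starting with the list `occ` of occupied spots.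
unitPark : ℕ → List ℕ → List ℕ → Maybe (List ℕ)
unitPark n occ [] = just occ
unitPark n occ (a ∷ as) with a ∈? occ
... | no _ = unitPark n (a ∷ occ) as
... | yes _ with suc a ≤? n | suc a ∈? occ
...   | yes _ | no _ = unitPark n (suc a ∷ occ) as
...   | _     | _    = nothing

UPF : ℕ → List ℕ → Set
UPF n α = (length α ≡ n) × All (λ a → 1 ≤ a × a ≤ n) α × Is-just (unitPark n [] α)

-- Cutting a weakly increasing list at positions i (1-indexed) with a'_i = i.
-- splitBlocks i xs, where xs starts at position i, returns
-- (entries before the first block start, list of blocks from there on).
splitBlocks : ℕ → List ℕ → List ℕ × List (List ℕ)
splitBlocks i [] = [] , []
splitBlocks i (x ∷ xs) with splitBlocks (suc i) xs | x ≟ i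
... | p , bs | yes _ = [] , (x ∷ p) ∷ bs
... | p , bs | no _  = x ∷ p , bs

-- block structure π_1 | ... | π_m of α (for a parking function, a'_1 = 1,
-- so the first component of splitBlocks is empty)
blocks : List ℕ → List (List ℕ)
blocks α = proj₂ (splitBlocks 1 (sortℕ α))

multinomial : List ℕ → ℕ
multinomial [] = 1
multinomial (k ∷ ks) = ((k + sum ks) C k) * multinomial ks

-- Sorting a unit interval parking function puts every entry a′ᵢ on or just below the diagonal,
-- i − 1 ≤ a′ᵢ ≤ i: the cars preferring a spot ≤ k can only take the spots 1, …, k + 1, and those
-- preferring a spot > k only the spots k + 1, …, n.  So every block reads c, c, c + 1, …, c + k − 1,
-- its cars can only fill the spots c, …, c + k, and the blocks tile 1, …, n.  Cars of different
-- blocks never compete for a spot, hence a rearrangement parks iff each block parks on its own.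
-- Within a block, a car arriving before a smaller car of its block parks at its own preference and
-- leaves the smaller cars one spot short; so each block must arrive in increasing order.  The
-- rearrangements doing so are the shuffles of the blocks, counted by the multinomial coefficient.
module Submission where

open import Defs
open import Data.Nat using (ℕ; _≟_)
open import Data.List using (List; length; map; filter)
open import Data.List.Membership.Propositional using (_∈_)
open import Data.List.Membership.DecPropositional _≟_ using (_∈?_)
open import Data.List.Relation.Unary.All using (All)
open import Data.List.Relation.Unary.Unique.Propositional using (Unique)
open import Data.List.Relation.Binary.Permutation.Propositional using (_↭_)
open import Data.Product using (Σ; _×_)
open import Function.Bundles using (_⇔_)
open import Relation.Binary.PropositionalEquality using (_≡_)

open import Level using (0ℓ)
open import Data.Nat using (suc; zero; _+_; _*_; _∸_; _≤_; _<_; _≤?_; _<?_; z≤n; s≤s; z<s)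
open import Data.Nat.Properties
open import Data.Nat.Combinatorics using (_C_; nCn≡1; nCk+nC[k+1]≡[n+1]C[k+1])
open import Data.Nat.ListAction using (sum)
open import Data.List using ([]; _∷_; [_]; _++_; iterate; concat; concatMap)
open import Data.List.Properties
  using (filter-accept; filter-reject; filter-all; filter-none; length-filter; length-iterate; length-++; length-map;
         ∷-injectiveˡ; ∷-injectiveʳ)
open import Data.List.Membership.Propositional using (_∉_)
open import Data.List.Membership.Propositional.Properties
  using (∈-map⁺; ∈-map⁻; ∈-++⁺ˡ; ∈-++⁺ʳ; ∈-++⁻; ∈-concat⁺′; ∈-concat⁻′)
open import Data.List.Relation.Unary.Any using (here; there)
open import Data.List.Relation.Unary.All using ([]; _∷_)
import Data.List.Relation.Unary.All as All
open import Data.List.Relation.Unary.All.Properties using (all-filter; concat⁺)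
open import Data.List.Relation.Unary.AllPairs using (AllPairs; []; _∷_)
import Data.List.Relation.Unary.AllPairs as AllPairs
import Data.List.Relation.Unary.Unique.Propositional.Properties as Unique
open import Data.List.Relation.Unary.Linked using (Linked)
import Data.List.Relation.Unary.Linked as Linked
open import Data.List.Relation.Unary.Linked.Properties using (Linked⇒All)
open import Data.List.Relation.Binary.Disjoint.Propositional using (Disjoint)
open import Data.List.Relation.Binary.Permutation.Propositional using (↭-refl; ↭-sym; ↭-trans; ↭-reflexive)
open import Data.List.Relation.Binary.Permutation.Propositional.Properties
  using (∈-resp-↭; All-resp-↭; ↭-length; filter-↭; drop-∷; ++⁺ˡ; ↭-empty-inv; ↭-singleton-inv; ¬x∷xs↭[])
open import Data.List.Relation.Ternary.Interleaving.Propositional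
  using (Interleaving; []; consˡ; consʳ; swap; toPermutation)
open import Data.List.Relation.Ternary.Interleaving.Propositional.Properties
  using (++-linear) renaming (filter⁺ to interleaving-filter)
open import Data.List.Relation.Ternary.Interleaving.Properties using (interleave-length)
open import Data.List.Sort.InsertionSort.Properties ≤-decTotalOrder using (sort-↭; sort-↗)
open import Data.Maybe using (Maybe; just; nothing; Is-just; _>>=_)
import Data.Maybe.Relation.Unary.Any as Maybe
open import Data.Product using (∃; ∃₂; _,_; proj₁; proj₂)
import Data.Product as Product
open import Data.Sum using (inj₁; inj₂; _⊎_)
open import Data.Empty using (⊥-elim)
open import Data.Unit using (tt)
open import Function using (_∘_)
open import Function.Bundles using (mk⇔; Equivalence)
open import Function.Construct.Composition using () renaming (equivalence to ⇔-trans)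
open import Function.Construct.Symmetry using (⇔-sym)
open import Relation.Nullary using (¬_; Dec; yes; no; contradiction)
open import Relation.Unary using (Pred; Decidable; ∁)
open import Relation.Unary.Properties using (∁?)
open import Relation.Binary.PropositionalEquality using (_≢_; refl; sym; trans; cong; cong₂; subst; module ≡-Reasoning)

open Equivalence using (to; from)

-- Counting and filtering

module _ {A : Set} where

  count : {P : Pred A 0ℓ} → Decidable P → List A → ℕ
  count P? xs = length (filter P? xs)

  count-accept : ∀ {P : Pred A 0ℓ} (P? : Decidable P) {x xs} → P x → count P? (x ∷ xs) ≡ suc (count P? xs)
  count-accept P? px = cong length (filter-accept P? px)

  count-reject : ∀ {P : Pred A 0ℓ} (P? : Decidable P) {x xs} → ¬ P x → count P? (x ∷ xs) ≡ count P? xs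
  count-reject P? ¬px = cong length (filter-reject P? ¬px)

  count-↭ : ∀ {P : Pred A 0ℓ} (P? : Decidable P) {xs ys} → xs ↭ ys → count P? xs ≡ count P? ys
  count-↭ P? xs↭ys = ↭-length (filter-↭ P? xs↭ys)

  count-split : ∀ {P : Pred A 0ℓ} (P? : Decidable P) xs → length xs ≡ count P? xs + count (∁? P?) xs
  count-split P? xs = interleave-length {L = _≡_} {R = _≡_} (interleaving-filter P? xs)

  module _ {P Q : Pred A 0ℓ} (P? : Decidable P) (Q? : Decidable Q) (P⇒Q : ∀ {x} → P x → Q x) where

    count-mono : ∀ xs → count P? xs ≤ count Q? xs
    count-mono [] = z≤n
    count-mono (x ∷ xs) with P? x | Q? x
    ... | yes _  | yes _  = s≤s (count-mono xs)
    ... | yes px | no ¬qx = contradiction (P⇒Q px) ¬qx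
    ... | no _   | yes _  = m≤n⇒m≤1+n (count-mono xs)
    ... | no _   | no _   = count-mono xs

    count-mono-< : ∀ {x xs} → x ∈ xs → ¬ P x → Q x → count P? xs < count Q? xs
    count-mono-< {x} {y ∷ xs} (here refl) ¬px qx with P? x | Q? x
    ... | yes px | _      = contradiction px ¬px
    ... | no _   | yes _  = s≤s (count-mono xs)
    ... | no _   | no ¬qx = contradiction qx ¬qx
    count-mono-< {x} {y ∷ xs} (there x∈xs) ¬px qx with P? y | Q? y
    ... | yes _  | yes _  = s≤s (count-mono-< x∈xs ¬px qx)
    ... | yes py | no ¬qy = contradiction (P⇒Q py) ¬qy
    ... | no _   | yes _  = m≤n⇒m≤1+n (count-mono-< x∈xs ¬px qx)
    ... | no _   | no _   = count-mono-< x∈xs ¬px qx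

  filter-interleaving : ∀ {P : Pred A 0ℓ} (P? : Decidable P) {xs ys zs} → Interleaving xs ys zs →
    All (∁ P) xs → filter P? zs ≡ filter P? ys
  filter-interleaving P? []            []           = refl
  filter-interleaving P? (consˡ split) (¬px ∷ ¬pxs) = trans (filter-reject P? ¬px) (filter-interleaving P? split ¬pxs)
  filter-interleaving P? {zs = y ∷ _} (consʳ split) ¬pxs with P? y
  ... | yes _ = cong (y ∷_) (filter-interleaving P? split ¬pxs)
  ... | no _  = filter-interleaving P? split ¬pxs

  Disjoint-concat : ∀ {π : List A} πs → All (Disjoint π) πs → Disjoint π (concat πs)
  Disjoint-concat πs π#πs (x∈π , x∈πs) with ∈-concat⁻′ πs x∈πs
  ... | _ , x∈π′ , π′∈πs = All.lookup π#πs π′∈πs (x∈π , x∈π′)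

  Disjoint-respʳ-↭ : ∀ {π τ τ′ : List A} → Disjoint π τ′ → τ ↭ τ′ → Disjoint π τ
  Disjoint-respʳ-↭ π#τ′ τ↭τ′ (x∈π , x∈τ) = π#τ′ (x∈π , ∈-resp-↭ τ↭τ′ x∈τ)

Respects : List (List ℕ) → List ℕ → Set
Respects πs σ = All (λ π → filter (_∈? π) σ ≡ π) πs

module _ {π : List ℕ} where

  filters-interleaving : ∀ {τ σ} → Disjoint π τ → Interleaving π τ σ →
    filter (_∈? π) σ ≡ π × filter (∁? (_∈? π)) σ ≡ τ
  filters-interleaving {τ} {σ} π#τ split =
    trans (filter-interleaving (_∈? π) (swap split) (All.tabulate (λ x∈τ x∈π → π#τ (x∈π , x∈τ))))
          (filter-all (_∈? π) (All.tabulate (λ x∈π → x∈π))) ,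
    trans (filter-interleaving (∁? (_∈? π)) split (All.tabulate (λ x∈π x∉π → x∉π x∈π)))
          (filter-all (∁? (_∈? π)) (All.tabulate (λ x∈τ x∈π → π#τ (x∈π , x∈τ))))

  filters-↭ : ∀ {τ σ} → Disjoint π τ → σ ↭ π ++ τ → filter (_∈? π) σ ↭ π × filter (∁? (_∈? π)) σ ↭ τ
  filters-↭ {τ} {σ} π#τ σ↭ with filters-interleaving π#τ (++-linear π τ)
  ... | inπ , outπ = ↭-trans (filter-↭ (_∈? π) σ↭) (↭-reflexive inπ) ,
                     ↭-trans (filter-↭ (∁? (_∈? π)) σ↭) (↭-reflexive outπ)

  Respects-∷ : ∀ {πs σ} → All (Disjoint π) πs →
    Respects (π ∷ πs) σ ⇔ (filter (_∈? π) σ ≡ π × Respects πs (filter (∁? (_∈? π)) σ))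
  Respects-∷ {πs} {σ} π#πs =
    mk⇔ (λ { (inπ ∷ rest) → inπ , All.zipWith (λ (eq , r) → trans eq r) (same , rest) })
        (λ (inπ , rest) → inπ ∷ All.zipWith (λ (eq , r) → trans (sym eq) r) (same , rest))
    where
    same : All (λ π′ → filter (_∈? π′) (filter (∁? (_∈? π)) σ) ≡ filter (_∈? π′) σ) πs
    same = All.map (λ π#π′ → sym (filter-interleaving (_∈? _) (interleaving-filter (_∈? π) σ)
                                   (All.map (λ x∈π x∈π′ → π#π′ (x∈π , x∈π′)) (all-filter (_∈? π) σ))))
                   π#πs

-- Runs of consecutive numbers and blocks

∈-iterate⁺ : ∀ {x} a m → a ≤ x → x < a + m → x ∈ iterate suc a m
∈-iterate⁺ a zero a≤x x<a+0 = contradiction (≤-trans x<a+0 (≤-reflexive (+-identityʳ a))) (≤⇒≯ a≤x)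
∈-iterate⁺ {x} a (suc m) a≤x x<a+m with a ≟ x
... | yes refl = here refl
... | no a≢x   = there (∈-iterate⁺ (suc a) m (≤∧≢⇒< a≤x a≢x) (subst (x <_) (+-suc a m) x<a+m))

∈-iterate⁻ : ∀ {x} a m → x ∈ iterate suc a m → ∃₂ λ d e → x ≡ a + d × m ≡ d + suc e
∈-iterate⁻ a (suc m) (here refl) = 0 , m , sym (+-identityʳ a) , refl
∈-iterate⁻ a (suc m) (there x∈) with ∈-iterate⁻ (suc a) m x∈
... | d , e , refl , refl = suc d , e , sym (+-suc a d) , refl

∈-iterate-bounds : ∀ {x} a m → x ∈ iterate suc a m → a ≤ x × x < a + m
∈-iterate-bounds a m x∈ with ∈-iterate⁻ a m x∈
... | d , _ , refl , refl = m≤m+n a d , +-monoʳ-< a (m<m+n d z<s)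

count-<-iterate : ∀ a d e → count (_<? a + d) (iterate suc a (d + e)) ≡ d
count-<-iterate a zero e rewrite +-identityʳ a = none a e ≤-refl
  where
  none : ∀ b e → a ≤ b → count (_<? a) (iterate suc b e) ≡ 0
  none b zero    a≤b = refl
  none b (suc e) a≤b = trans (count-reject (_<? a) (≤⇒≯ a≤b)) (none (suc b) e (m≤n⇒m≤1+n a≤b))
count-<-iterate a (suc d) e = begin
  count (_<? a + suc d) (iterate suc a (suc d + e))  ≡⟨ count-accept (_<? a + suc d) (m<m+n a z<s) ⟩
  suc (count (_<? a + suc d) run)                    ≡⟨ cong (λ r → suc (count (_<? r) run)) (+-suc a d) ⟩
  suc (count (_<? suc a + d) run)                    ≡⟨ cong suc (count-<-iterate (suc a) d e) ⟩
  suc d                                              ∎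
  where
  open ≡-Reasoning
  run = iterate suc (suc a) (d + e)

∈-↭-∷ : ∀ {r x : ℕ} {τ L} → r ∷ τ ↭ x ∷ L → r ≢ x → r ∈ L
∈-↭-∷ r∷τ↭ r≢x with ∈-resp-↭ r∷τ↭ (here refl)
... | here r≡x  = contradiction r≡x r≢x
... | there r∈L = r∈L

-- the cars of a block prefer c, c, c + 1, …, c + k − 1 and fill the spots c, …, c + k
block : ℕ → ℕ → List ℕ
block c k = c ∷ iterate suc c k

blockSeq : ℕ → List ℕ → List (List ℕ)
blockSeq c []       = []
blockSeq c (k ∷ ks) = block c k ∷ blockSeq (suc c + k) ks

∈-block : ∀ {x} c k → x ∈ block c k → c ≤ x × x ≤ c + k
∈-block c k (here refl) = ≤-refl , m≤m+n c k
∈-block c k (there x∈)  = Product.map₂ <⇒≤ (∈-iterate-bounds c k x∈)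

block-disjoint : ∀ {c k τ} → All (suc c + k ≤_) τ → Disjoint (block c k) τ
block-disjoint {c} {k} above (x∈π , x∈τ) = ≤⇒≯ (proj₂ (∈-block c k x∈π)) (All.lookup above x∈τ)

blockSeq-lower : ∀ c ks → All (All (c ≤_)) (blockSeq c ks)
blockSeq-lower c []       = []
blockSeq-lower c (k ∷ ks) = All.tabulate (λ x∈π → proj₁ (∈-block c k x∈π))
                          ∷ All.map (All.map (≤-trans (≤-trans (m≤m+n c k) (n≤1+n _)))) (blockSeq-lower (suc c + k) ks)

concat-blockSeq-lower : ∀ c ks → All (c ≤_) (concat (blockSeq c ks))
concat-blockSeq-lower c ks = concat⁺ (blockSeq-lower c ks)

blockSeq-disjoint : ∀ c ks → AllPairs Disjoint (blockSeq c ks)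
blockSeq-disjoint c []       = []
blockSeq-disjoint c (k ∷ ks) =
  All.map block-disjoint (blockSeq-lower (suc c + k) ks) ∷ blockSeq-disjoint (suc c + k) ks

-- Sorted entries near the diagonal

-- the entry at each position j ≥ i is j or j − 1, where i is the position of the head
data NearDiagonal : ℕ → List ℕ → Set where
  []      : ∀ {i} → NearDiagonal i []
  diag    : ∀ {i xs} → NearDiagonal (suc i) xs → NearDiagonal i (i ∷ xs)
  subdiag : ∀ {i xs} → NearDiagonal (suc (suc i)) xs → NearDiagonal (suc i) (i ∷ xs)

-- p entries, all at most m, precede xs; the last two hypotheses are the counting bounds of a unit
-- interval parking function, restricted to k ≥ m so that the preceding entries count as p
sorted⇒nearDiagonal : ∀ p m xs → Linked _≤_ xs → All (m ≤_) xs → m ≤ p →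
  (∀ k → m ≤ k → k ≤ p + length xs → k ≤ p + count (_≤? k) xs) →
  (∀ k → m ≤ k → p + count (_≤? k) xs ≤ suc k) → NearDiagonal (suc p) xs
sorted⇒nearDiagonal p m []       _      _          _   _     _     = []
sorted⇒nearDiagonal p m (x ∷ xs) sorted (m≤x ∷ _) m≤p lower upper = shape (x ≟ suc p)
  where
  count-head : ∀ {k} → x ≤ k → p + count (_≤? k) (x ∷ xs) ≡ suc p + count (_≤? k) xs
  count-head x≤k = trans (cong (p +_) (count-accept (_≤? _) x≤k)) (+-suc p _)
  x≤xs : All (x ≤_) xs
  x≤xs = All.tail (Linked⇒All ≤-trans ≤-refl sorted)
  p≤x : p ≤ x
  p≤x = ≤-pred (≤-trans (m≤m+n (suc p) _) (≤-trans (≤-reflexive (sym (count-head ≤-refl))) (upper x m≤x)))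
  x≤p+1 : x ≤ suc p
  x≤p+1 with x ≤? suc p
  ... | yes x≤p+1 = x≤p+1
  ... | no x≰p+1  = contradiction (begin
      suc p                           ≤⟨ lower (suc p) (m≤n⇒m≤1+n m≤p) (m<m+n p z<s) ⟩
      p + count (_≤? suc p) (x ∷ xs)  ≡⟨ cong (λ ys → p + length ys) none ⟩
      p + 0                           ≡⟨ +-identityʳ p ⟩
      p                               ∎) 1+n≰n
    where
    open ≤-Reasoning
    none = filter-none (_≤? suc p) (x≰p+1 ∷ All.map (λ x≤y y≤p+1 → x≰p+1 (≤-trans x≤y y≤p+1)) x≤xs)
  rest : NearDiagonal (suc (suc p)) xs
  rest = sorted⇒nearDiagonal (suc p) x xs (Linked.tail sorted) x≤xs x≤p+1
    (λ k x≤k k≤ → ≤-trans (lower k (≤-trans m≤x x≤k) (≤-trans k≤ (≤-reflexive (sym (+-suc p _)))))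
                          (≤-reflexive (count-head x≤k)))
    (λ k x≤k → ≤-trans (≤-reflexive (sym (count-head x≤k))) (upper k (≤-trans m≤x x≤k)))
  shape : Dec (x ≡ suc p) → NearDiagonal (suc p) (x ∷ xs)
  shape (yes x≡p+1) = subst (λ y → NearDiagonal (suc p) (y ∷ xs)) (sym x≡p+1) (diag rest)
  shape (no x≢p+1)  = subst (λ y → NearDiagonal (suc p) (y ∷ xs))
                            (≤-antisym p≤x (≤-pred (≤∧≢⇒< x≤p+1 x≢p+1))) (subdiag rest)

splitBlocks-diag : ∀ i xs →
  splitBlocks i (i ∷ xs) ≡ ([] , (i ∷ proj₁ (splitBlocks (suc i) xs)) ∷ proj₂ (splitBlocks (suc i) xs))
splitBlocks-diag i xs with splitBlocks (suc i) xs | i ≟ i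
... | _ | yes _  = refl
... | _ | no i≢i = contradiction refl i≢i

splitBlocks-off : ∀ {i x} xs → x ≢ i →
  splitBlocks i (x ∷ xs) ≡ (x ∷ proj₁ (splitBlocks (suc i) xs) , proj₂ (splitBlocks (suc i) xs))
splitBlocks-off {i} {x} xs x≢i with splitBlocks (suc i) xs | x ≟ i
... | _ | yes x≡i = contradiction x≡i x≢i
... | _ | no _    = refl

splitBlocks-nearDiagonal : ∀ {p xs} → NearDiagonal (suc p) xs → ∃ λ k → ∃₂ λ c ks → suc p + k ≡ c ×
  splitBlocks (suc p) xs ≡ (iterate suc p k , blockSeq c ks) × iterate suc p k ++ concat (blockSeq c ks) ≡ xs
splitBlocks-nearDiagonal {p} [] = 0 , suc p , [] , cong suc (+-identityʳ p) , refl , refl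
splitBlocks-nearDiagonal {p} (diag {xs = xs} nd) with splitBlocks-nearDiagonal nd
... | k , _ , ks , refl , split , joined =
  0 , suc p , k ∷ ks , cong suc (+-identityʳ p) ,
  trans (splitBlocks-diag (suc p) xs) (cong (λ (l , πs) → [] , (suc p ∷ l) ∷ πs) split) , cong (suc p ∷_) joined
splitBlocks-nearDiagonal {p} (subdiag {xs = xs} nd) with splitBlocks-nearDiagonal nd
... | k , c , ks , eq , split , joined =
  suc k , c , ks , trans (cong suc (+-suc p k)) eq ,
  trans (splitBlocks-off {suc p} xs (1+n≢n ∘ sym)) (cong (Product.map₁ (p ∷_)) split) , cong (p ∷_) joined

-- Interleavings and shuffles

module _ {A : Set} where

  interleavings : List A → List A → List (List A)
  interleavings []       []       = [ [] ]
  interleavings []       (y ∷ ys) = map (y ∷_) (interleavings [] ys)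
  interleavings (x ∷ xs) []       = map (x ∷_) (interleavings xs [])
  interleavings (x ∷ xs) (y ∷ ys) = map (x ∷_) (interleavings xs (y ∷ ys)) ++ map (y ∷_) (interleavings (x ∷ xs) ys)

  interleavings⁻ : ∀ xs ys {zs} → zs ∈ interleavings xs ys → Interleaving xs ys zs
  interleavings⁻ [] [] (here refl) = []
  interleavings⁻ [] (y ∷ ys) zs∈ with ∈-map⁻ (y ∷_) zs∈
  ... | _ , ws∈ , refl = consʳ (interleavings⁻ [] ys ws∈)
  interleavings⁻ (x ∷ xs) [] zs∈ with ∈-map⁻ (x ∷_) zs∈
  ... | _ , ws∈ , refl = consˡ (interleavings⁻ xs [] ws∈)
  interleavings⁻ (x ∷ xs) (y ∷ ys) zs∈ with ∈-++⁻ (map (x ∷_) (interleavings xs (y ∷ ys))) zs∈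
  ... | inj₁ zs∈ˡ with ∈-map⁻ (x ∷_) zs∈ˡ
  ...   | _ , ws∈ , refl = consˡ (interleavings⁻ xs (y ∷ ys) ws∈)
  interleavings⁻ (x ∷ xs) (y ∷ ys) zs∈ | inj₂ zs∈ʳ with ∈-map⁻ (y ∷_) zs∈ʳ
  ...   | _ , ws∈ , refl = consʳ (interleavings⁻ (x ∷ xs) ys ws∈)

  interleavings⁺ : ∀ {xs ys zs} → Interleaving xs ys zs → zs ∈ interleavings xs ys
  interleavings⁺ [] = here refl
  interleavings⁺ {x ∷ xs} {[]}     (consˡ split) = ∈-map⁺ (x ∷_) (interleavings⁺ split)
  interleavings⁺ {x ∷ xs} {y ∷ ys} (consˡ split) = ∈-++⁺ˡ (∈-map⁺ (x ∷_) (interleavings⁺ split))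
  interleavings⁺ {[]}     {y ∷ ys} (consʳ split) = ∈-map⁺ (y ∷_) (interleavings⁺ split)
  interleavings⁺ {x ∷ xs} {y ∷ ys} (consʳ split) =
    ∈-++⁺ʳ (map (x ∷_) (interleavings xs (y ∷ ys))) (∈-map⁺ (y ∷_) (interleavings⁺ split))

  length-interleavings : ∀ xs ys → length (interleavings xs ys) ≡ (length xs + length ys) C length xs
  length-interleavings []       []       = refl
  length-interleavings []       (y ∷ ys) = trans (length-map (y ∷_) (interleavings [] ys)) (length-interleavings [] ys)
  length-interleavings (x ∷ xs) []       = begin
    length (map (x ∷_) (interleavings xs []))  ≡⟨ length-map (x ∷_) (interleavings xs []) ⟩
    length (interleavings xs [])               ≡⟨ length-interleavings xs [] ⟩
    (length xs + 0) C length xs                ≡⟨ cong (_C length xs) (+-identityʳ (length xs)) ⟩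
    length xs C length xs                      ≡⟨ trans (nCn≡1 (length xs)) (sym (nCn≡1 (suc (length xs)))) ⟩
    suc (length xs) C suc (length xs)          ≡⟨ cong (_C suc (length xs)) (+-identityʳ (suc (length xs))) ⟨
    (suc (length xs) + 0) C suc (length xs)    ∎
    where open ≡-Reasoning
  length-interleavings (x ∷ xs) (y ∷ ys) = begin
    length (map (x ∷_) L ++ map (y ∷_) R)          ≡⟨ length-++ (map (x ∷_) L) ⟩
    length (map (x ∷_) L) + length (map (y ∷_) R)  ≡⟨ cong₂ _+_ (length-map (x ∷_) L) (length-map (y ∷_) R) ⟩
    length L + length R                            ≡⟨ cong₂ _+_ (length-interleavings xs (y ∷ ys))
                                                                  (length-interleavings (x ∷ xs) ys) ⟩
    (m + suc k) C m + (suc m + k) C suc m          ≡⟨ cong (λ l → (m + suc k) C m + l C suc m) (+-suc m k) ⟨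
    (m + suc k) C m + (m + suc k) C suc m          ≡⟨ nCk+nC[k+1]≡[n+1]C[k+1] (m + suc k) m ⟩
    suc (m + suc k) C suc m                        ∎
    where
    open ≡-Reasoning
    L = interleavings xs (y ∷ ys)
    R = interleavings (x ∷ xs) ys
    m = length xs
    k = length ys

  interleavings-unique : ∀ xs ys → Disjoint xs ys → Unique (interleavings xs ys)
  interleavings-unique []       []       _     = [] ∷ []
  interleavings-unique []       (y ∷ ys) _     = Unique.map⁺ ∷-injectiveʳ (interleavings-unique [] ys (λ ()))
  interleavings-unique (x ∷ xs) []       _     = Unique.map⁺ ∷-injectiveʳ (interleavings-unique xs [] (λ { (_ , ()) }))
  interleavings-unique (x ∷ xs) (y ∷ ys) xs#ys =
    Unique.++⁺ (Unique.map⁺ ∷-injectiveʳ (interleavings-unique xs (y ∷ ys) (λ (v∈ , v∈ʸ) → xs#ys (there v∈ , v∈ʸ))))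
               (Unique.map⁺ ∷-injectiveʳ (interleavings-unique (x ∷ xs) ys (λ (v∈ˣ , v∈) → xs#ys (v∈ˣ , there v∈))))
               heads-differ
    where
    heads-differ : Disjoint (map (x ∷_) (interleavings xs (y ∷ ys))) (map (y ∷_) (interleavings (x ∷ xs) ys))
    heads-differ (v∈ˡ , v∈ʳ) with ∈-map⁻ (x ∷_) v∈ˡ | ∈-map⁻ (y ∷_) v∈ʳ
    ... | _ , _ , refl | _ , _ , eq = xs#ys (here refl , here (∷-injectiveˡ eq))

module _ {A B : Set} (f : A → List B) where

  ∈-concatMap⁻ : ∀ {y} xs → y ∈ concatMap f xs → ∃ λ x → x ∈ xs × y ∈ f x
  ∈-concatMap⁻ xs y∈ with ∈-concat⁻′ (map f xs) y∈
  ... | _ , y∈fx , fx∈ with ∈-map⁻ f fx∈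
  ...   | x , x∈ , refl = x , x∈ , y∈fx

  ∈-concatMap⁺ : ∀ {x y xs} → x ∈ xs → y ∈ f x → y ∈ concatMap f xs
  ∈-concatMap⁺ x∈ y∈fx = ∈-concat⁺′ y∈fx (∈-map⁺ f x∈)

  length-concatMap : ∀ {k} xs → All (λ x → length (f x) ≡ k) xs → length (concatMap f xs) ≡ length xs * k
  length-concatMap []       []            = refl
  length-concatMap (x ∷ xs) (fx≡k ∷ rest) = trans (length-++ (f x)) (cong₂ _+_ fx≡k (length-concatMap xs rest))

  -- g recovers x from every element of f x, so the lists f x are pairwise disjoint
  concatMap-unique : (g : B → A) → ∀ {xs} → Unique xs → (∀ {x} → x ∈ xs → Unique (f x)) →
    (∀ {x y} → x ∈ xs → y ∈ f x → g y ≡ x) → Unique (concatMap f xs)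
  concatMap-unique g {[]}     _             _        _       = []
  concatMap-unique g {x ∷ xs} (x∉xs ∷ uniq) unique-f inverse =
    Unique.++⁺ (unique-f (here refl)) (concatMap-unique g uniq (unique-f ∘ there) (inverse ∘ there)) disjoint
    where
    disjoint : Disjoint (f x) (concatMap f xs)
    disjoint (y∈fx , y∈rest) with ∈-concatMap⁻ xs y∈rest
    ... | x′ , x′∈ , y∈fx′ =
      All.lookup x∉xs x′∈ (trans (sym (inverse (here refl) y∈fx)) (inverse (there x′∈) y∈fx′))

module _ {A : Set} where

  shuffles : List (List A) → List (List A)
  shuffles []       = [ [] ]
  shuffles (π ∷ πs) = concatMap (interleavings π) (shuffles πs)

  shuffles-length : ∀ πs → All (λ σ → length σ ≡ sum (map length πs)) (shuffles πs)
  shuffles-length []       = refl ∷ []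
  shuffles-length (π ∷ πs) = All.tabulate length-σ
    where
    length-σ : ∀ {σ} → σ ∈ shuffles (π ∷ πs) → length σ ≡ sum (map length (π ∷ πs))
    length-σ σ∈ with ∈-concatMap⁻ (interleavings π) (shuffles πs) σ∈
    ... | τ , τ∈ , σ∈′ = trans (interleave-length (interleavings⁻ π τ σ∈′))
                               (cong (length π +_) (All.lookup (shuffles-length πs) τ∈))

  length-shuffles : ∀ πs → length (shuffles πs) ≡ multinomial (map length πs)
  length-shuffles []       = refl
  length-shuffles (π ∷ πs) = begin
    length (concatMap (interleavings π) (shuffles πs))   ≡⟨ length-concatMap (interleavings π) (shuffles πs) each ⟩
    length (shuffles πs) * K                             ≡⟨ cong (_* K) (length-shuffles πs) ⟩
    multinomial (map length πs) * K                      ≡⟨ *-comm (multinomial (map length πs)) K ⟩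
    multinomial (map length (π ∷ πs))                    ∎
    where
    open ≡-Reasoning
    K = (length π + sum (map length πs)) C length π
    each : All (λ τ → length (interleavings π τ) ≡ K) (shuffles πs)
    each = All.map (λ {τ} τ-length → trans (length-interleavings π τ)
                                           (cong (λ l → (length π + l) C length π) τ-length))
                   (shuffles-length πs)

∈-shuffles : ∀ {πs σ} → AllPairs Disjoint πs → σ ∈ shuffles πs ⇔ (σ ↭ concat πs × Respects πs σ)
∈-shuffles {[]} [] = mk⇔ (λ { (here refl) → ↭-refl , [] }) (λ (σ↭ , _) → here (↭-empty-inv σ↭))
∈-shuffles {π ∷ πs} {σ} (π#πs ∷ disjoint) = mk⇔ shuffle⁻ shuffle⁺
  where
  shuffle⁻ : σ ∈ shuffles (π ∷ πs) → σ ↭ π ++ concat πs × Respects (π ∷ πs) σ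
  shuffle⁻ σ∈ with ∈-concatMap⁻ (interleavings π) (shuffles πs) σ∈
  ... | τ , τ∈ , σ∈′ with to (∈-shuffles disjoint) τ∈
  ...   | τ↭ , respects with interleavings⁻ π τ σ∈′
  ...     | split with filters-interleaving {π} (Disjoint-respʳ-↭ (Disjoint-concat πs π#πs) τ↭) split
  ...       | inπ , outπ = ↭-trans (toPermutation split) (++⁺ˡ π τ↭) ,
                           from (Respects-∷ {σ = σ} π#πs) (inπ , subst (Respects πs) (sym outπ) respects)
  shuffle⁺ : σ ↭ π ++ concat πs × Respects (π ∷ πs) σ → σ ∈ shuffles (π ∷ πs)
  shuffle⁺ (σ↭ , respects) with to (Respects-∷ {σ = σ} π#πs) respects
  ... | inπ , rest = ∈-concatMap⁺ (interleavings π)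
                       (from (∈-shuffles disjoint) (proj₂ (filters-↭ {π} (Disjoint-concat πs π#πs) σ↭) , rest))
                       (interleavings⁺ (subst (λ l → Interleaving l (filter (∁? (_∈? π)) σ) σ) inπ
                                              (interleaving-filter (_∈? π) σ)))

shuffles-unique : ∀ {πs} → AllPairs Disjoint πs → Unique (shuffles πs)
shuffles-unique {[]}     []                = [] ∷ []
shuffles-unique {π ∷ πs} (π#πs ∷ disjoint) =
  concatMap-unique (interleavings π) (filter (∁? (_∈? π))) (shuffles-unique disjoint)
    (λ {τ} τ∈ → interleavings-unique π τ (π#τ τ∈))
    (λ {τ} τ∈ σ∈ → proj₂ (filters-interleaving (π#τ τ∈) (interleavings⁻ π τ σ∈)))
  where
  π#τ : ∀ {τ} → τ ∈ shuffles πs → Disjoint π τ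
  π#τ τ∈ = Disjoint-respʳ-↭ (Disjoint-concat πs π#πs) (proj₁ (to (∈-shuffles disjoint) τ∈))

-- Unit interval parking

free : List ℕ → List ℕ → ℕ
free O = count (∁? (_∈? O))

free-[] : ∀ S → free [] S ≡ length S
free-[] S = cong length (filter-all (∁? (_∈? [])) {S} (All.tabulate (λ _ ())))

free-∷ : ∀ p O S → free (p ∷ O) S ≤ free O S
free-∷ p O = count-mono (∁? (_∈? p ∷ O)) (∁? (_∈? O)) (_∘ there)

free-∷-< : ∀ {p O S} → p ∉ O → p ∈ S → free (p ∷ O) S < free O S
free-∷-< {p} {O} p∉O p∈S =
  count-mono-< (∁? (_∈? p ∷ O)) (∁? (_∈? O)) (_∘ there) p∈S (λ p∉p∷O → p∉p∷O (here refl)) p∉O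

Vacant : List ℕ → ℕ → ℕ → Set
Vacant O lo hi = ∀ {x} → lo ≤ x → x ≤ hi → x ∉ O

_≈[_]_ : List ℕ → Pred ℕ 0ℓ → List ℕ → Set
O ≈[ R ] O′ = ∀ {x} → R x → x ∈ O ⇔ x ∈ O′

≈-refl : ∀ R {O} → O ≈[ R ] O
≈-refl R _ = mk⇔ (λ x → x) (λ x → x)

≈-∷ : ∀ {R O O′} p → O ≈[ R ] O′ → (p ∷ O) ≈[ R ] (p ∷ O′)
≈-∷ p O≈O′ Rx = mk⇔ (λ { (here x≡p) → here x≡p ; (there x∈O) → there (to (O≈O′ Rx) x∈O) })
                     (λ { (here x≡p) → here x≡p ; (there x∈O′) → there (from (O≈O′ Rx) x∈O′) })

≈-∷ˡ : ∀ {R O O′ p} → ¬ R p → O ≈[ R ] O′ → (p ∷ O) ≈[ R ] O′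
≈-∷ˡ ¬Rp O≈O′ Rx = mk⇔ (λ { (here refl) → contradiction Rx ¬Rp ; (there x∈O) → to (O≈O′ Rx) x∈O })
                        (λ x∈O′ → there (from (O≈O′ Rx) x∈O′))

module Parking (n : ℕ) where

  Parks : List ℕ → List ℕ → Set
  Parks O σ = Is-just (unitPark n O σ)

  spotFor : List ℕ → ℕ → Maybe ℕ
  spotFor O a with a ∈? O
  ... | no _ = just a
  ... | yes _ with suc a ≤? n | suc a ∈? O
  ...   | yes _ | no _ = just (suc a)
  ...   | _     | _    = nothing

  unitPark-∷ : ∀ O a σ → unitPark n O (a ∷ σ) ≡ (spotFor O a >>= λ p → unitPark n (p ∷ O) σ)
  unitPark-∷ O a σ with a ∈? O
  ... | no _ = refl
  ... | yes _ with suc a ≤? n | suc a ∈? O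
  ...   | yes _ | no _  = refl
  ...   | yes _ | yes _ = refl
  ...   | no _  | _     = refl

  Parks-∷ : ∀ {O a p} σ → spotFor O a ≡ just p → Parks O (a ∷ σ) ⇔ Parks (p ∷ O) σ
  Parks-∷ {O} {a} σ eq rewrite unitPark-∷ O a σ | eq = mk⇔ (λ parks → parks) (λ parks → parks)

  Parks-∷-stuck : ∀ {O a} σ → spotFor O a ≡ nothing → ¬ Parks O (a ∷ σ)
  Parks-∷-stuck {O} {a} σ eq parks rewrite unitPark-∷ O a σ | eq with parks
  ... | ()

  Parks-∷⁻ : ∀ {O a} σ → Parks O (a ∷ σ) → ∃ λ p → spotFor O a ≡ just p × Parks (p ∷ O) σ
  Parks-∷⁻ {O} {a} σ parks with spotFor O a in eq
  ... | just p  = p , refl , to (Parks-∷ {O} {a} σ eq) parks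
  ... | nothing = contradiction parks (Parks-∷-stuck {O} {a} σ eq)

  spotFor-free : ∀ {O a} → a ∉ O → spotFor O a ≡ just a
  spotFor-free {O} {a} a∉O with a ∈? O
  ... | no _    = refl
  ... | yes a∈O = contradiction a∈O a∉O

  spotFor-next : ∀ {O a} → a ∈ O → suc a ≤ n → suc a ∉ O → spotFor O a ≡ just (suc a)
  spotFor-next {O} {a} a∈O a<n a+1∉O with a ∈? O
  ... | no a∉O = contradiction a∈O a∉O
  ... | yes _ with suc a ≤? n | suc a ∈? O
  ...   | yes _  | no _      = refl
  ...   | yes _  | yes a+1∈O = contradiction a+1∈O a+1∉O
  ...   | no a≮n | _         = contradiction a<n a≮n

  spotFor-spec : ∀ {O a p} → spotFor O a ≡ just p → p ∉ O × (p ≡ a ⊎ (p ≡ suc a × suc a ≤ n))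
  spotFor-spec {O} {a} eq with a ∈? O
  spotFor-spec {O} {a} refl | no a∉O = a∉O , inj₁ refl
  ... | yes _ with suc a ≤? n | suc a ∈? O
  spotFor-spec {O} {a} refl | yes _ | yes a<n | no a+1∉O = a+1∉O , inj₂ (refl , a<n)

  spotFor-≈ : ∀ {R O O′ a} → O ≈[ R ] O′ → R a → R (suc a) → spotFor O a ≡ spotFor O′ a
  spotFor-≈ {O = O} {O′} {a} O≈O′ Ra Ra+1 with a ∈? O | a ∈? O′
  ... | no _    | no _     = refl
  ... | no a∉O  | yes a∈O′ = contradiction (from (O≈O′ Ra) a∈O′) a∉O
  ... | yes a∈O | no a∉O′  = contradiction (to (O≈O′ Ra) a∈O) a∉O′
  ... | yes _   | yes _ with suc a ≤? n | suc a ∈? O | suc a ∈? O′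
  ...   | no _  | _       | _        = refl
  ...   | yes _ | no _    | no _     = refl
  ...   | yes _ | yes _   | yes _    = refl
  ...   | yes _ | no b∉O  | yes b∈O′ = contradiction (from (O≈O′ Ra+1) b∈O′) b∉O
  ...   | yes _ | yes b∈O | no b∉O′  = contradiction (to (O≈O′ Ra+1) b∈O) b∉O′

  -- every car takes a spot that was free, and a car satisfying P can only take a spot in S
  parked≤free : ∀ {P : Pred ℕ 0ℓ} (P? : Decidable P) {O} S σ → Parks O σ →
    All (λ r → P r → r ∈ S × (suc r ≤ n → suc r ∈ S)) σ → count P? σ ≤ free O S
  parked≤free P? S [] _ _ = z≤n
  parked≤free P? {O} S (r ∷ σ) parks (spots ∷ spotsσ) with Parks-∷⁻ σ parks
  ... | p , eq , parks′ with spotFor-spec eq | P? r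
  ...   | p∉O , taken | yes pr = ≤-trans (s≤s (parked≤free P? S σ parks′ spotsσ)) (free-∷-< p∉O (p∈S taken))
    where
    p∈S : p ≡ r ⊎ (p ≡ suc r × suc r ≤ n) → p ∈ S
    p∈S (inj₁ refl)         = proj₁ (spots pr)
    p∈S (inj₂ (refl , r<n)) = proj₂ (spots pr) r<n
  ...   | _ | no _ = ≤-trans (parked≤free P? S σ parks′ spotsσ) (free-∷ p O S)

  -- a car preferring x ∈ [lo, r) takes x or x + 1 ≤ r, and r is already taken
  parked-below≤free : ∀ {O} lo d r τ → lo + d ≡ r → Parks (r ∷ O) τ → All (λ x → x < r → lo ≤ x) τ →
    count (_<? r) τ ≤ free (r ∷ O) (iterate suc lo d)
  parked-below≤free {O} lo d r τ refl parks lower = begin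
    count (_<? r) τ                      ≤⟨ parked≤free (_<? r) (r ∷ iterate suc lo d) τ parks (All.map spots lower) ⟩
    free (r ∷ O) (r ∷ iterate suc lo d)  ≡⟨ count-reject (∁? (_∈? r ∷ O)) (λ r∉ → r∉ (here refl)) ⟩
    free (r ∷ O) (iterate suc lo d)      ∎
    where
    open ≤-Reasoning
    next : ∀ {x} → lo ≤ x → suc x ≤ r → suc x ∈ r ∷ iterate suc lo d
    next {x} lo≤x x<r with suc x ≟ r
    ... | yes x+1≡r = here x+1≡r
    ... | no x+1≢r  = there (∈-iterate⁺ lo d (m≤n⇒m≤1+n lo≤x) (≤∧≢⇒< x<r x+1≢r))
    spots : ∀ {x} → (x < r → lo ≤ x) → x < r →
      x ∈ r ∷ iterate suc lo d × (suc x ≤ n → suc x ∈ r ∷ iterate suc lo d)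
    spots lo≤ x<r = there (∈-iterate⁺ lo d (lo≤ x<r) x<r) , λ _ → next (lo≤ x<r) x<r

  run-parks⇔sorted : ∀ {O} a m τ → a ∈ O → Vacant O (suc a) (a + m) → a + m ≤ n →
    τ ↭ iterate suc a m → Parks O τ ⇔ τ ≡ iterate suc a m
  run-parks⇔sorted a zero τ _ _ _ τ↭ rewrite ↭-empty-inv τ↭ = mk⇔ (λ _ → refl) (λ _ → Maybe.just tt)
  run-parks⇔sorted a (suc m) [] _ _ _ τ↭ = contradiction (↭-sym τ↭) ¬x∷xs↭[]
  run-parks⇔sorted {O} a (suc m) (r ∷ τ) a∈O vacant a+m≤n τ↭ with r ≟ a
  ... | yes refl = ⇔-trans (Parks-∷ τ moves-up) (⇔-trans ih (mk⇔ (cong (a ∷_)) ∷-injectiveʳ))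
    where
    a<a+m : suc a ≤ a + suc m
    a<a+m = ≤-trans (s≤s (m≤m+n a m)) (≤-reflexive (sym (+-suc a m)))
    moves-up : spotFor O a ≡ just (suc a)
    moves-up = spotFor-next a∈O (≤-trans a<a+m a+m≤n) (vacant ≤-refl a<a+m)
    vacant′ : Vacant (suc a ∷ O) (suc (suc a)) (suc a + m)
    vacant′ a+1<x _  (here refl) = <-irrefl refl a+1<x
    vacant′ a+1<x x≤ (there x∈O) = vacant (<⇒≤ a+1<x) (≤-trans x≤ (≤-reflexive (sym (+-suc a m)))) x∈O
    ih = run-parks⇔sorted (suc a) m τ (here refl) vacant′ (≤-trans (≤-reflexive (sym (+-suc a m))) a+m≤n) (drop-∷ τ↭)
  ... | no r≢a = mk⇔ (λ parks → ⊥-elim (jammed (to (Parks-∷ τ (spotFor-free r∉O)) parks)))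
                     (λ eq → contradiction (∷-injectiveˡ eq) r≢a)
    where
    r∈run : r ∈ iterate suc (suc a) m
    r∈run = ∈-↭-∷ τ↭ r≢a
    r∉O : r ∉ O
    r∉O = vacant (proj₁ (∈-iterate-bounds (suc a) m r∈run))
                 (≤-trans (≤-pred (proj₂ (∈-iterate-bounds (suc a) m r∈run))) (+-monoʳ-≤ a (n≤1+n m)))
    lower : All (λ x → x < r → a ≤ x) τ
    lower = All.tabulate (λ x∈τ _ → proj₁ (∈-iterate-bounds a (suc m) (∈-resp-↭ τ↭ (there x∈τ))))
    -- r overtook the cars a, …, r − 1, which now have only the spots a + 1, …, r − 1 left
    jammed : ¬ Parks (r ∷ O) τ
    jammed parks with ∈-iterate⁻ (suc a) m r∈run
    ... | d , e , refl , refl = <-irrefl refl (begin-strict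
      d                                                        ≡⟨ count-<-iterate (suc a) d (suc e) ⟨
      count (_<? r) (iterate suc (suc a) (d + suc e))  <⟨ ≤-reflexive (sym (count-accept (_<? r) (s≤s (m≤m+n a d)))) ⟩
      count (_<? r) (iterate suc a (suc (d + suc e)))  ≡⟨ count-↭ (_<? r) τ↭ ⟨
      count (_<? r) (r ∷ τ)                            ≡⟨ count-reject (_<? r) (<-irrefl refl) ⟩
      count (_<? r) τ                                  ≤⟨ parked-below≤free a (suc d) r τ (+-suc a d) parks lower ⟩
      free (r ∷ O) (iterate suc a (suc d))             ≡⟨ count-reject (∁? (_∈? r ∷ O)) (λ a∉ → a∉ (there a∈O)) ⟩
      free (r ∷ O) (iterate suc (suc a) d)             ≤⟨ length-filter (∁? (_∈? r ∷ O)) (iterate suc (suc a) d) ⟩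
      length (iterate suc (suc a) d)                   ≡⟨ length-iterate suc (suc a) d ⟩
      d                                                ∎)
      where open ≤-Reasoning

  block-parks⇔sorted : ∀ {O} c k τ → Vacant O c (c + k) → c + k ≤ n → τ ↭ block c k → Parks O τ ⇔ τ ≡ block c k
  block-parks⇔sorted c k [] _ _ τ↭ = contradiction (↭-sym τ↭) ¬x∷xs↭[]
  block-parks⇔sorted {O} c k (r ∷ τ) vacant c+k≤n τ↭ with r ≟ c
  ... | yes refl =
    ⇔-trans (Parks-∷ τ (spotFor-free (vacant ≤-refl (m≤m+n c k)))) (⇔-trans ih (mk⇔ (cong (c ∷_)) ∷-injectiveʳ))
    where
    vacant′ : Vacant (c ∷ O) (suc c) (c + k)
    vacant′ c<x _  (here refl) = <-irrefl refl c<x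
    vacant′ c<x x≤ (there x∈O) = vacant (<⇒≤ c<x) x≤ x∈O
    ih = run-parks⇔sorted c k τ (here refl) vacant′ c+k≤n (drop-∷ τ↭)
  ... | no r≢c = mk⇔ (λ parks → ⊥-elim (jammed (to (Parks-∷ τ (spotFor-free r∉O)) parks)))
                     (λ eq → contradiction (∷-injectiveˡ eq) r≢c)
    where
    r∈run : r ∈ iterate suc c k
    r∈run = ∈-↭-∷ τ↭ r≢c
    r∉O : r ∉ O
    r∉O = vacant (proj₁ (∈-iterate-bounds c k r∈run)) (<⇒≤ (proj₂ (∈-iterate-bounds c k r∈run)))
    lower : All (λ x → x < r → c ≤ x) τ
    lower = All.tabulate (λ x∈τ _ → proj₁ (∈-block c k (∈-resp-↭ τ↭ (there x∈τ))))
    -- r overtook the cars c, c, …, r − 1, which now have only the spots c, …, r − 1 left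
    jammed : ¬ Parks (r ∷ O) τ
    jammed parks with ∈-iterate⁻ c k r∈run
    ... | zero  , _ , refl , _    = contradiction (+-identityʳ c) r≢c
    ... | suc d , e , refl , refl = <-irrefl refl (begin-strict
      suc d                                                  ≡⟨ count-<-iterate c (suc d) (suc e) ⟨
      count (_<? r) (iterate suc c (suc d + suc e))  <⟨ ≤-reflexive (sym (count-accept (_<? r) (m<m+n c z<s))) ⟩
      count (_<? r) (block c (suc d + suc e))        ≡⟨ count-↭ (_<? r) τ↭ ⟨
      count (_<? r) (r ∷ τ)                          ≡⟨ count-reject (_<? r) (<-irrefl refl) ⟩
      count (_<? r) τ                                ≤⟨ parked-below≤free c (suc d) r τ refl parks lower ⟩
      free (r ∷ O) (iterate suc c (suc d))           ≤⟨ length-filter (∁? (_∈? r ∷ O)) (iterate suc c (suc d)) ⟩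
      length (iterate suc c (suc d))                 ≡⟨ length-iterate suc c (suc d) ⟩
      suc d                                          ∎)
      where open ≤-Reasoning

  -- both spots a low car may take lie below c, so low and high cars never compete for a spot
  parks-split : ∀ {c O Oˡ Oʰ σˡ σʰ σ} → Interleaving σˡ σʰ σ → All (λ r → suc r < c) σˡ → All (c ≤_) σʰ →
    O ≈[ _< c ] Oˡ → O ≈[ c ≤_ ] Oʰ → Parks O σ ⇔ (Parks Oˡ σˡ × Parks Oʰ σʰ)
  parks-split [] _ _ _ _ = mk⇔ (λ _ → Maybe.just tt , Maybe.just tt) (λ _ → Maybe.just tt)
  parks-split {c} {O} {Oˡ} {Oʰ} {r ∷ σˡ} {σʰ} {r ∷ σ} (consˡ split) (r<c ∷ low) high Oˡ≈ Oʰ≈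
    with spotFor O r in eq
  ... | nothing = mk⇔ (λ parks → contradiction parks (Parks-∷-stuck {O} {r} σ eq))
                      (λ parks → contradiction (proj₁ parks) (Parks-∷-stuck {Oˡ} {r} σˡ (trans (sym eqˡ) eq)))
    where eqˡ = spotFor-≈ Oˡ≈ (<-trans (n<1+n r) r<c) r<c
  ... | just p = ⇔-trans (Parks-∷ σ eq)
                   (⇔-trans (parks-split split low high (≈-∷ p Oˡ≈) (≈-∷ˡ (<⇒≱ p<c) Oʰ≈))
                            (mk⇔ (Product.map₁ (from (Parks-∷ σˡ eqˡ))) (Product.map₁ (to (Parks-∷ σˡ eqˡ)))))
    where
    eqˡ = trans (sym (spotFor-≈ Oˡ≈ (<-trans (n<1+n r) r<c) r<c)) eq
    p<c : p < c
    p<c with proj₂ (spotFor-spec {O} {r} eq)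
    ... | inj₁ refl       = <-trans (n<1+n r) r<c
    ... | inj₂ (refl , _) = r<c
  parks-split {c} {O} {Oˡ} {Oʰ} {σˡ} {r ∷ σʰ} {r ∷ σ} (consʳ split) low (c≤r ∷ high) Oˡ≈ Oʰ≈
    with spotFor O r in eq
  ... | nothing = mk⇔ (λ parks → contradiction parks (Parks-∷-stuck {O} {r} σ eq))
                      (λ parks → contradiction (proj₂ parks) (Parks-∷-stuck {Oʰ} {r} σʰ (trans (sym eqʰ) eq)))
    where eqʰ = spotFor-≈ Oʰ≈ c≤r (m≤n⇒m≤1+n c≤r)
  ... | just p = ⇔-trans (Parks-∷ σ eq)
                   (⇔-trans (parks-split split low high (≈-∷ˡ (≤⇒≯ c≤p) Oˡ≈) (≈-∷ p Oʰ≈))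
                            (mk⇔ (Product.map₂ (from (Parks-∷ σʰ eqʰ))) (Product.map₂ (to (Parks-∷ σʰ eqʰ)))))
    where
    eqʰ = trans (sym (spotFor-≈ Oʰ≈ c≤r (m≤n⇒m≤1+n c≤r))) eq
    c≤p : c ≤ p
    c≤p with proj₂ (spotFor-spec {O} {r} eq)
    ... | inj₁ refl       = c≤r
    ... | inj₂ (refl , _) = m≤n⇒m≤1+n c≤r

  -- a lone car at a vacant spot c parks there, and no other car ever looks at spot c
  parks-skip : ∀ {c O Oʰ σʰ σ} → Interleaving [ c ] σʰ σ → c ∉ O → All (suc c ≤_) σʰ →
    O ≈[ suc c ≤_ ] Oʰ → Parks O σ ⇔ Parks Oʰ σʰ
  parks-skip {c} {O} {Oʰ} {σʰ} {c ∷ σ} (consˡ split) c∉O high Oʰ≈ =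
    ⇔-trans (Parks-∷ σ (spotFor-free c∉O))
      (⇔-trans (parks-split split [] high (≈-refl (_< suc c)) (≈-∷ˡ (<-irrefl refl) Oʰ≈))
               (mk⇔ proj₂ (Maybe.just tt ,_)))
  parks-skip {c} {O} {Oʰ} {r ∷ σʰ} {r ∷ σ} (consʳ split) c∉O (c<r ∷ high) Oʰ≈ with spotFor O r in eq
  ... | nothing = mk⇔ (λ parks → contradiction parks (Parks-∷-stuck {O} {r} σ eq))
                      (λ parks → contradiction parks (Parks-∷-stuck {Oʰ} {r} σʰ (trans (sym eqʰ) eq)))
    where eqʰ = spotFor-≈ Oʰ≈ c<r (m≤n⇒m≤1+n c<r)
  ... | just p = ⇔-trans (Parks-∷ σ eq) (⇔-trans (parks-skip split c∉p∷O high (≈-∷ p Oʰ≈)) (⇔-sym (Parks-∷ σʰ eqʰ)))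
    where
    eqʰ = trans (sym (spotFor-≈ Oʰ≈ c<r (m≤n⇒m≤1+n c<r))) eq
    c<p : c < p
    c<p with proj₂ (spotFor-spec {O} {r} eq)
    ... | inj₁ refl       = c<r
    ... | inj₂ (refl , _) = m≤n⇒m≤1+n c<r
    c∉p∷O : c ∉ p ∷ O
    c∉p∷O (here refl) = <-irrefl refl c<p
    c∉p∷O (there c∈O) = c∉O c∈O

  parks-first-block : ∀ c k {σ} τ → σ ↭ block c k ++ τ → All (suc c + k ≤_) τ → c + k ≤ n →
    Parks [] σ ⇔ (filter (_∈? block c k) σ ≡ block c k × Parks [] (filter (∁? (_∈? block c k)) σ))
  parks-first-block c zero {σ} τ σ↭ above _ =
    mk⇔ (λ parks → lone , to skip parks) (λ (_ , parks) → from skip parks)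
    where
    parts = filters-↭ (block-disjoint above) σ↭
    lone : filter (_∈? [ c ]) σ ≡ [ c ]
    lone = ↭-singleton-inv (proj₁ parts)
    high : All (suc c ≤_) (filter (∁? (_∈? [ c ])) σ)
    high = All-resp-↭ (↭-sym (proj₂ parts)) (subst (λ b → All (b ≤_) τ) (cong suc (+-identityʳ c)) above)
    skip : Parks [] σ ⇔ Parks [] (filter (∁? (_∈? [ c ])) σ)
    skip = parks-skip (subst (λ l → Interleaving l (filter (∁? (_∈? [ c ])) σ) σ) lone
                             (interleaving-filter (_∈? [ c ]) σ))
                      (λ ()) high (≈-refl (suc c ≤_))
  parks-first-block c (suc k) {σ} τ σ↭ above c+k≤n =
    ⇔-trans (parks-split (interleaving-filter (_∈? π) σ) low high
                         (≈-refl (_< suc c + suc k)) (≈-refl (suc c + suc k ≤_)))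
            (mk⇔ (Product.map₁ (to sorted)) (Product.map₁ (from sorted)))
    where
    π = block c (suc k)
    parts = filters-↭ (block-disjoint above) σ↭
    below : ∀ {r} → r ∈ π → r < c + suc k
    below (here refl) = m<m+n c z<s
    below (there r∈)  = proj₂ (∈-iterate-bounds c (suc k) r∈)
    low : All (λ r → suc r < suc c + suc k) (filter (_∈? π) σ)
    low = All.tabulate (λ r∈ → s≤s (below (∈-resp-↭ (proj₁ parts) r∈)))
    high : All (suc c + suc k ≤_) (filter (∁? (_∈? π)) σ)
    high = All-resp-↭ (↭-sym (proj₂ parts)) above
    sorted = block-parks⇔sorted c (suc k) (filter (_∈? π) σ) (λ _ _ ()) c+k≤n (proj₁ parts)

  parks⇔respects : ∀ c ks σ → σ ↭ concat (blockSeq c ks) → c + length (concat (blockSeq c ks)) ≤ suc n →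
    Parks [] σ ⇔ Respects (blockSeq c ks) σ
  parks⇔respects c []       σ σ↭ _ rewrite ↭-empty-inv σ↭ = mk⇔ (λ _ → []) (λ _ → Maybe.just tt)
  parks⇔respects c (k ∷ ks) σ σ↭ fits =
    ⇔-trans (parks-first-block c k rest σ↭ above c+k≤n)
            (⇔-trans (mk⇔ (Product.map₂ (to ih)) (Product.map₂ (from ih)))
                     (⇔-sym (Respects-∷ {σ = σ} (AllPairs.head (blockSeq-disjoint c (k ∷ ks))))))
    where
    rest = concat (blockSeq (suc c + k) ks)
    above = concat-blockSeq-lower (suc c + k) ks
    fits′ : suc c + k + length rest ≤ suc n
    fits′ = ≤-trans (≤-reflexive (begin-equality
      suc c + k + length rest                           ≡⟨ cong suc (+-assoc c k (length rest)) ⟩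
      suc (c + (k + length rest))                       ≡⟨ +-suc c (k + length rest) ⟨
      c + suc (k + length rest)                         ≡⟨ cong (λ l → c + suc (l + length rest)) (length-iterate suc c k) ⟨
      c + suc (length (iterate suc c k) + length rest)  ≡⟨ cong (λ l → c + suc l) (length-++ (iterate suc c k)) ⟨
      c + length (block c k ++ rest)                    ∎)) fits
      where open ≤-Reasoning
    c+k≤n : c + k ≤ n
    c+k≤n = ≤-pred (≤-trans (s≤s (m≤m+n (c + k) (length rest))) fits′)
    ih = parks⇔respects (suc c + k) ks (filter (∁? (_∈? block c k)) σ)
                        (proj₂ (filters-↭ (block-disjoint above) σ↭)) fits′

  -- cars preferring a spot ≤ k can only take the spots 1, …, k + 1
  count-≤-upper : ∀ {α} k → Parks [] α → All (1 ≤_) α → count (_≤? k) α ≤ suc k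
  count-≤-upper {α} k parks positive = begin
    count (_≤? k) α                  ≤⟨ parked≤free (_≤? k) (iterate suc 1 (suc k)) α parks (All.map spots positive) ⟩
    free [] (iterate suc 1 (suc k))  ≡⟨ free-[] (iterate suc 1 (suc k)) ⟩
    length (iterate suc 1 (suc k))   ≡⟨ length-iterate suc 1 (suc k) ⟩
    suc k                            ∎
    where
    open ≤-Reasoning
    spots : ∀ {r} → 1 ≤ r → r ≤ k → r ∈ iterate suc 1 (suc k) × (suc r ≤ n → suc r ∈ iterate suc 1 (suc k))
    spots 1≤r r≤k = ∈-iterate⁺ 1 (suc k) 1≤r (s≤s (m≤n⇒m≤1+n r≤k)) ,
                    λ _ → ∈-iterate⁺ 1 (suc k) (s≤s z≤n) (s≤s (s≤s r≤k))

  -- cars preferring a spot > k can only take the spots k + 1, …, n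
  count-≤-lower : ∀ {α} k → Parks [] α → All (_≤ n) α → length α ≡ n → k ≤ n → k ≤ count (_≤? k) α
  count-≤-lower {α} k parks bounded len k≤n = +-cancelʳ-≤ (count (∁? (_≤? k)) α) k (count (_≤? k) α) (begin
    k + count (∁? (_≤? k)) α                ≤⟨ +-monoʳ-≤ k above ⟩
    k + (n ∸ k)                             ≡⟨ m+[n∸m]≡n k≤n ⟩
    n                                       ≡⟨ len ⟨
    length α                                ≡⟨ count-split (_≤? k) α ⟩
    count (_≤? k) α + count (∁? (_≤? k)) α  ∎)
    where
    open ≤-Reasoning
    S = iterate suc (suc k) (n ∸ k)
    top : suc n ≡ suc k + (n ∸ k)
    top = cong suc (sym (m+[n∸m]≡n k≤n))
    spots : ∀ {r} → r ≤ n → ¬ r ≤ k → r ∈ S × (suc r ≤ n → suc r ∈ S)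
    spots r≤n r≰k = ∈-iterate⁺ (suc k) (n ∸ k) (≰⇒> r≰k) (subst (_<_ _) top (s≤s r≤n)) ,
                    λ r<n → ∈-iterate⁺ (suc k) (n ∸ k) (m≤n⇒m≤1+n (≰⇒> r≰k)) (subst (_<_ _) top (s≤s r<n))
    above : count (∁? (_≤? k)) α ≤ n ∸ k
    above = ≤-trans (parked≤free (∁? (_≤? k)) S α parks (All.map spots bounded))
                    (≤-reflexive (trans (free-[] S) (length-iterate suc (suc k) (n ∸ k))))

  UPF⇒nearDiagonal : ∀ {α} → UPF n α → NearDiagonal 1 (sortℕ α)
  UPF⇒nearDiagonal {α} (len , bounded , parks) =
    sorted⇒nearDiagonal 0 0 (sortℕ α) (sort-↗ α) (All.tabulate (λ _ → z≤n)) z≤n lower upper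
    where
    sorted-count : ∀ k → count (_≤? k) α ≡ count (_≤? k) (sortℕ α)
    sorted-count k = count-↭ (_≤? k) (↭-sym (sort-↭ α))
    lower : ∀ k → 0 ≤ k → k ≤ length (sortℕ α) → k ≤ count (_≤? k) (sortℕ α)
    lower k _ k≤ = subst (k ≤_) (sorted-count k)
      (count-≤-lower k parks (All.map proj₂ bounded) len (subst (k ≤_) (trans (↭-length (sort-↭ α)) len) k≤))
    upper : ∀ k → 0 ≤ k → count (_≤? k) (sortℕ α) ≤ suc k
    upper k _ = subst (_≤ suc k) (sorted-count k) (count-≤-upper k parks (All.map proj₁ bounded))

  UPF⇒blockSeq : ∀ {α} → UPF n α → ∃ λ ks → blocks α ≡ blockSeq 1 ks × concat (blockSeq 1 ks) ≡ sortℕ α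
  UPF⇒blockSeq {α} upf with splitBlocks-nearDiagonal (UPF⇒nearDiagonal upf)
  ... | zero  , _ , ks , refl , split , joined = ks , cong proj₂ split , joined
  ... | suc k , _ , ks , _    , _     , joined =
    contradiction (proj₁ (All.lookup (proj₁ (proj₂ upf)) 0∈α)) λ ()
    where
    0∈α : 0 ∈ α
    0∈α = ∈-resp-↭ (sort-↭ α) (subst (0 ∈_) joined (here refl))

  UPF⇔Parks : ∀ {α σ} → UPF n α → σ ↭ α → UPF n σ ⇔ Parks [] σ
  UPF⇔Parks (len , bounded , _) σ↭ =
    mk⇔ (proj₂ ∘ proj₂) (λ parks → trans (↭-length σ↭) len , All-resp-↭ (↭-sym σ↭) bounded , parks)

theorem2p9 : (n : ℕ) (α : List ℕ) → UPF n α →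
    (Σ (List (List ℕ)) (λ L → Unique L × (∀ σ → σ ∈ L ⇔ (σ ↭ α × UPF n σ))
        × length L ≡ multinomial (map length (blocks α))))
    × (∀ σ → σ ↭ α →
        (UPF n σ ⇔ All (λ π → filter (_∈? π) σ ≡ π) (blocks α)))
theorem2p9 n α upf with Parking.UPF⇒blockSeq n upf
... | ks , blocks≡ , sorted rewrite blocks≡ =
  (shuffles πs , shuffles-unique disjoint , members , length-shuffles πs) , characterization
  where
  open Parking n
  πs = blockSeq 1 ks
  disjoint = blockSeq-disjoint 1 ks
  πs↭α : concat πs ↭ α
  πs↭α = ↭-trans (↭-reflexive sorted) (sort-↭ α)
  fits : 1 + length (concat πs) ≤ suc n
  fits = ≤-reflexive (cong suc (trans (↭-length πs↭α) (proj₁ upf)))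
  characterization : ∀ σ → σ ↭ α → UPF n σ ⇔ Respects πs σ
  characterization σ σ↭ = ⇔-trans (UPF⇔Parks upf σ↭) (parks⇔respects 1 ks σ (↭-trans σ↭ (↭-sym πs↭α)) fits)
  members : ∀ σ → σ ∈ shuffles πs ⇔ (σ ↭ α × UPF n σ)
  members σ = ⇔-trans (∈-shuffles disjoint)
    (mk⇔ (λ (σ↭ , respects) → ↭-trans σ↭ πs↭α , from (characterization σ (↭-trans σ↭ πs↭α)) respects)
         (λ (σ↭ , upf′) → ↭-trans σ↭ (↭-sym πs↭α) , to (characterization σ σ↭) upf′))
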